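{- Let $H_1,H_2$ be hyperplanes of $T$ and let $u_1,u_2\in V'$ with $ru_1\notin H_1$ and $ru_2\notin H_2$. If the sets $C(H_1,u_1)$ and $C(H_2,u_2)$ have an element in common, then they coincide.
   Context: Let $e\geq 2$ and let $K$ be a finite commutative ring with identity having precisely three ideals $\{0\}$, $J=\langle r\rangle$, $K$, with $K/J\cong\mathbb{F}_q$ ($q$ a prime power). Let $K^\times$ be the set of units, $V'$ the set of tuples in $K^{2e}$ with at least one entry in $K^\times$, and for $a\in V'$ let $[a]=\{\lambda a:\lambda\in K^\times\}$. Let $T=J^{2e}$; it is a $2e$-dimensional vector space over $K/J$ with scalar multiplication $(z+J)\cdot x=zx$. A hyperplane is a $(2e-1)$-dimensional subspace of $T$. For $u\in K^{2e}$, $ru$ denotes the componentwise product, an element of $T$. For a hyperplane $H$ and $u\in V'$ with $ru\notin H$, $C(H,u)=\{[u+h]: h\in H\}$. -}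

module Defs where

open import Level using (Level; _⊔_) renaming (suc to lsuc)
open import Algebra.Bundles using (CommutativeRing)
open import Data.Nat using (ℕ; zero; suc; _∸_)
open import Data.Fin using (Fin; zero; suc)
open import Data.Product using (Σ; ∃; _×_; _,_)
open import Data.Sum using (_⊎_)
open import Relation.Nullary using (¬_)
open import Relation.Unary using (Pred)

module RingDefs {c ℓ : Level} (R : CommutativeRing c ℓ) where
  open CommutativeRing R using (Carrier; _≈_; _+_; _*_; 0#; 1#)

  Finite : Set (c ⊔ ℓ)
  Finite = Σ ℕ λ n → Σ (Fin n → Carrier) λ f → ∀ x → Σ (Fin n) λ i → f i ≈ x

  record IsIdeal (I : Pred Carrier (c ⊔ ℓ)) : Set (c ⊔ ℓ) where
    field
      resp  : ∀ {x y} → x ≈ y → I x → I y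
      zero∈ : I 0#
      +∈    : ∀ {x y} → I x → I y → I (x + y)
      *∈    : ∀ a {x} → I x → I (a * x)

  ⟨_⟩ : Carrier → Pred Carrier (c ⊔ ℓ)
  ⟨ r ⟩ x = Σ Carrier λ y → x ≈ r * y

  IsZeroSet : Pred Carrier (c ⊔ ℓ) → Set (c ⊔ ℓ)
  IsZeroSet I = (∀ x → I x → x ≈ 0#) × (∀ x → x ≈ 0# → I x)

  SameSet : Pred Carrier (c ⊔ ℓ) → Pred Carrier (c ⊔ ℓ) → Set (c ⊔ ℓ)
  SameSet I J = (∀ x → I x → J x) × (∀ x → J x → I x)

  IsFullSet : Pred Carrier (c ⊔ ℓ) → Set (c ⊔ ℓ)
  IsFullSet I = ∀ x → I x

  ExactlyThreeIdeals : Carrier → Set (lsuc (c ⊔ ℓ))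
  ExactlyThreeIdeals r =
    ((I : Pred Carrier (c ⊔ ℓ)) → IsIdeal I →
       IsZeroSet I ⊎ SameSet I ⟨ r ⟩ ⊎ IsFullSet I)
    × ¬ IsZeroSet ⟨ r ⟩ × ¬ IsFullSet ⟨ r ⟩ × ¬ (1# ≈ 0#)

  IsUnit : Carrier → Set (c ⊔ ℓ)
  IsUnit x = Σ Carrier λ y → x * y ≈ 1#

  Tup : ℕ → Set c
  Tup m = Fin m → Carrier

  _≋_ : ∀ {m} → Tup m → Tup m → Set ℓ
  u ≋ v = ∀ i → u i ≈ v i

  _⊕_ : ∀ {m} → Tup m → Tup m → Tup m
  (u ⊕ v) i = u i + v i

  _·_ : ∀ {m} → Carrier → Tup m → Tup m
  (a · u) i = a * u i

  𝟎 : ∀ {m} → Tup m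
  𝟎 i = 0#

  lincomb : ∀ {m} (n : ℕ) → (Fin n → Carrier) → (Fin n → Tup m) → Tup m
  lincomb zero    a v = 𝟎
  lincomb (suc n) a v = (a zero · v zero) ⊕ lincomb n (λ i → a (suc i)) (λ i → v (suc i))

  InV' : ∀ {m} → Tup m → Set (c ⊔ ℓ)
  InV' u = Σ (Fin _) λ i → IsUnit (u i)

  InT : ∀ {m} → Carrier → Tup m → Set (c ⊔ ℓ)
  InT r x = ∀ i → ⟨ r ⟩ (x i)

  -- H is a K/J-subspace of T. Scalars z + J act by x ↦ z x, so closure under
  -- K/J-scalar multiplication is closure under multiplication by elements of K.
  record IsSubspace (r : Carrier) {m : ℕ} (H : Pred (Tup m) (c ⊔ ℓ)) : Set (c ⊔ ℓ) where
    field
      resp  : ∀ {x y} → x ≋ y → H x → H y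
      ⊆T    : ∀ {x} → H x → InT r x
      zero∈ : H 𝟎
      +∈    : ∀ {x y} → H x → H y → H (x ⊕ y)
      ·∈    : ∀ z {x} → H x → H (z · x)

  -- b : Fin d → H is a basis of H over K/J (coefficients z + J represented by z ∈ K;
  -- z + J = 0 in K/J iff z ∈ J)
  record IsBasis (r : Carrier) {m d : ℕ} (H : Pred (Tup m) (c ⊔ ℓ))
                 (b : Fin d → Tup m) : Set (c ⊔ ℓ) where
    field
      inH     : ∀ i → H (b i)
      spans   : ∀ {x} → H x → Σ (Fin d → Carrier) λ a → x ≋ lincomb d a b
      indep   : ∀ (a : Fin d → Carrier) → lincomb d a b ≋ 𝟎 → ∀ i → ⟨ r ⟩ (a i)

  IsSubspaceOfDim : (r : Carrier) {m : ℕ} → ℕ → Pred (Tup m) (c ⊔ ℓ) → Set (c ⊔ ℓ)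
  IsSubspaceOfDim r d H = IsSubspace r H × Σ (Fin d → Tup _) (IsBasis r H)

  IsHyperplane : (r : Carrier) {m : ℕ} → Pred (Tup m) (c ⊔ ℓ) → Set (c ⊔ ℓ)
  IsHyperplane r {m} H = IsSubspaceOfDim r (m ∸ 1) H

  Cls : ∀ {m} → Tup m → Pred (Tup m) (c ⊔ ℓ)
  Cls a x = Σ Carrier λ λ′ → IsUnit λ′ × x ≋ (λ′ · a)

  _≐_ : ∀ {m} → Pred (Tup m) (c ⊔ ℓ) → Pred (Tup m) (c ⊔ ℓ) → Set (c ⊔ ℓ)
  X ≐ Y = (∀ x → X x → Y x) × (∀ x → Y x → X x)

  -- membership of a set of tuples X in C(H,u) = { [u + h] : h ∈ H }
  _∈C[_,_] : ∀ {m} → Pred (Tup m) (c ⊔ ℓ) → Pred (Tup m) (c ⊔ ℓ) → Tup m → Set (c ⊔ ℓ)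
  X ∈C[ H , u ] = Σ (Tup _) λ h → H h × (X ≐ Cls (u ⊕ h))

  CMeet : ∀ {m} → Pred (Tup m) (c ⊔ ℓ) → Tup m → Pred (Tup m) (c ⊔ ℓ) → Tup m → Set (lsuc (c ⊔ ℓ))
  CMeet {m} H₁ u₁ H₂ u₂ = Σ (Pred (Tup m) (c ⊔ ℓ)) λ X → X ∈C[ H₁ , u₁ ] × X ∈C[ H₂ , u₂ ]

  CEq : ∀ {m} → Pred (Tup m) (c ⊔ ℓ) → Tup m → Pred (Tup m) (c ⊔ ℓ) → Tup m → Set (lsuc (c ⊔ ℓ))
  CEq {m} H₁ u₁ H₂ u₂ = (X : Pred (Tup m) (c ⊔ ℓ)) →
    (X ∈C[ H₁ , u₁ ] → X ∈C[ H₂ , u₂ ]) × (X ∈C[ H₂ , u₂ ] → X ∈C[ H₁ , u₁ ])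

{-# OPTIONS --safe #-}
module Submission where

-- K is local with maximal ideal J = ⟨r⟩, and r² = 0, so J annihilates T = J^m and T is a
-- K/J-vector space of dimension m: Gaussian elimination over K/J makes any m + 1 elements of T
-- dependent, hence a hyperplane H with r·u ∉ H is complemented by K·(r·u). Now if
-- u₁ + h₁ = α (u₂ + h₂) and g ∈ H₁, write α⁻¹ (g - h₁) = k + s·(r·u₂) with k ∈ H₂; then
-- u₁ + g = α (1 + s r) (u₂ + h₂ + k), since r kills h₂ + k, and 1 + s r is a unit.
-- So C(H₁,u₁) ⊆ C(H₂,u₂) as soon as the two meet, and symmetrically.

open import Defs
open import Level using (Level; _⊔_)
open import Relation.Unary using (Pred)
open import Algebra.Bundles using (CommutativeRing)
open import Data.Nat using (ℕ; _≤_; zero; suc; _<_; _∸_; s≤s)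
open import Data.Nat.Properties using (m≤n+m∸n)
open import Data.Fin using (Fin; zero; suc; punchIn; punchOut)
open import Data.Fin.Properties using (punchIn-punchOut; _≟_)
open import Data.Vec.Functional using (_∷_; removeAt)
open import Data.Product using (Σ; _×_; _,_; proj₁; proj₂)
open import Data.Sum using (_⊎_; inj₁; inj₂)
open import Data.Empty using (⊥-elim)
open import Relation.Nullary using (¬_; yes; no)
open import Function using (_∘′_)
import Relation.Binary.PropositionalEquality as ≡

module _ {c ℓ : Level} (K : CommutativeRing c ℓ) where
  open CommutativeRing K hiding (zero)
  open RingDefs K
  open import Algebra.Properties.Ring ring
    using (-1*x≈-x; -‿distribˡ-*; -‿distribʳ-*; +-inverseˡ-unique)
  open import Algebra.Properties.Semiring.Sum semiring
    using (sum; sum-cong-≋; ∑-distrib-+; *-distribʳ-sum; *-distribˡ-sum; sum-replicate-zero)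
  open import Algebra.Properties.CommutativeSemigroup *-commutativeSemigroup
    using (interchange; x∙yz≈y∙xz; xy∙z≈x∙zy)
  open import Algebra.Properties.CommutativeSemigroup +-commutativeSemigroup
    using () renaming (interchange to +-interchange)
  open import Algebra.Solver.Ring.NaturalCoefficients.Default commutativeSemiring
    using (solve; _:=_; _:+_; _:*_)
  open import Relation.Binary.Reasoning.Setoid setoid

  isUnit-* : ∀ {x y} → IsUnit x → IsUnit y → IsUnit (x * y)
  isUnit-* {x} {y} (x′ , xx′≈1) (y′ , yy′≈1) = x′ * y′ , (begin
    (x * y) * (x′ * y′) ≈⟨ interchange x y x′ y′ ⟩
    (x * x′) * (y * y′) ≈⟨ *-cong xx′≈1 yy′≈1 ⟩
    1# * 1#             ≈⟨ *-identityˡ 1# ⟩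
    1#                  ∎)

  inverse-cancelˡ : ∀ {x x′} → x * x′ ≈ 1# → ∀ y → x′ * (x * y) ≈ y
  inverse-cancelˡ {x} {x′} xx′≈1 y = begin
    x′ * (x * y) ≈⟨ *-assoc x′ x y ⟨
    (x′ * x) * y ≈⟨ *-congʳ (trans (*-comm x′ x) xx′≈1) ⟩
    1# * y       ≈⟨ *-identityˡ y ⟩
    y            ∎

  x*w≈1∧xy+z≈0⇒y≈-wz : ∀ {x w y z} → x * w ≈ 1# → x * y + z ≈ 0# → y ≈ - w * z
  x*w≈1∧xy+z≈0⇒y≈-wz {x} {w} {y} {z} xw≈1 xy+z≈0 = begin
    y            ≈⟨ inverse-cancelˡ xw≈1 y ⟨
    w * (x * y)  ≈⟨ *-congˡ (+-inverseˡ-unique (x * y) z xy+z≈0) ⟩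
    w * - z      ≈⟨ -‿distribʳ-* w z ⟨
    - (w * z)    ≈⟨ -‿distribˡ-* w z ⟩
    - w * z      ∎

  [x+y]+[z-y]≈x+z : ∀ x y z → (x + y) + (z + - 1# * y) ≈ x + z
  [x+y]+[z-y]≈x+z x y z = begin
    (x + y) + (z + - 1# * y) ≈⟨ +-interchange x y z (- 1# * y) ⟩
    (x + z) + (y + - 1# * y) ≈⟨ +-congˡ (trans (+-congˡ (-1*x≈-x y)) (-‿inverseʳ y)) ⟩
    (x + z) + 0#             ≈⟨ +-identityʳ (x + z) ⟩
    x + z                    ∎

  a[x+y]+a[z+w]≈a[x+[y+z]+w] : ∀ a x y z w → a * (x + y) + a * (z + w) ≈ a * (x + (y + z) + w)
  a[x+y]+a[z+w]≈a[x+[y+z]+w] =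
    solve 5 (λ a x y z w → a :* (x :+ y) :+ a :* (z :+ w) := a :* (x :+ (y :+ z) :+ w)) refl

  x∈⟨x⟩ : ∀ x → ⟨ x ⟩ x
  x∈⟨x⟩ x = 1# , sym (*-identityʳ x)

  ⟨⟩-isIdeal : ∀ x → IsIdeal ⟨ x ⟩
  ⟨⟩-isIdeal x = record
    { resp  = λ { y≈z (a , y≈xa) → a , trans (sym y≈z) y≈xa }
    ; zero∈ = 0# , sym (zeroʳ x)
    ; +∈    = λ { (a , y≈xa) (b , z≈xb) → a + b , trans (+-cong y≈xa z≈xb) (sym (distribˡ x a b)) }
    ; *∈    = λ { a (b , y≈xb) → a * b , trans (*-congˡ y≈xb) (x∙yz≈y∙xz a x b) }
    }

  Cls-refl : ∀ {m} (a : Tup m) → Cls a a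
  Cls-refl a = 1# , (1# , *-identityʳ 1#) , λ i → sym (*-identityˡ (a i))

  Cls-⊆ : ∀ {m μ} {a b : Tup m} → IsUnit μ → a ≋ (μ · b) → ∀ x → Cls a x → Cls b x
  Cls-⊆ {μ = μ} {a} {b} μ-unit a≋μb x (ν , ν-unit , x≋νa) =
    ν * μ , isUnit-* ν-unit μ-unit ,
    λ i → trans (x≋νa i) (trans (*-congˡ (a≋μb i)) (sym (*-assoc ν μ (b i))))

  Cls-cong : ∀ {m μ} {a b : Tup m} → IsUnit μ → a ≋ (μ · b) → Cls a ≐ Cls b
  Cls-cong {μ = μ} {a} {b} μ-unit@(μ′ , μμ′≈1) a≋μb =
    Cls-⊆ μ-unit a≋μb , Cls-⊆ (μ , trans (*-comm μ′ μ) μμ′≈1) b≋μ′a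
    where
    b≋μ′a : b ≋ (μ′ · a)
    b≋μ′a i = trans (sym (inverse-cancelˡ μμ′≈1 (b i))) (*-congˡ (sym (a≋μb i)))

  ≐-trans : ∀ {m} {X Y Z : Pred (Tup m) (c ⊔ ℓ)} → X ≐ Y → Y ≐ Z → X ≐ Z
  ≐-trans (X⊆Y , Y⊆X) (Y⊆Z , Z⊆Y) = (λ x → Y⊆Z x ∘′ X⊆Y x) , (λ x → Y⊆X x ∘′ Z⊆Y x)

  sum≈0 : ∀ {n} {f : Fin n → Carrier} → (∀ k → f k ≈ 0#) → sum f ≈ 0#
  sum≈0 {n} f≈0 = trans (sum-cong-≋ f≈0) (sum-replicate-zero n)

  lincomb-apply : ∀ {m} n a (v : Fin n → Tup m) i → lincomb n a v i ≈ sum (λ k → a k * v k i)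
  lincomb-apply zero    a v i = refl
  lincomb-apply (suc n) a v i = +-congˡ (lincomb-apply n (λ k → a (suc k)) (λ k → v (suc k)) i)

  lincomb-reindex : ∀ {m m′} n a (v : Fin n → Tup m) (f : Fin m′ → Fin m) j →
                    lincomb n a (λ k → v k ∘′ f) j ≈ lincomb n a v (f j)
  lincomb-reindex n a v f j = trans (lincomb-apply n a _ j) (sym (lincomb-apply n a v (f j)))

  lincomb∈ : ∀ {r m} {H : Pred (Tup m) (c ⊔ ℓ)} → IsSubspace r H →
             ∀ n a (v : Fin n → Tup m) → (∀ k → H (v k)) → H (lincomb n a v)
  lincomb∈ H-sub zero    a v v∈H = IsSubspace.zero∈ H-sub
  lincomb∈ H-sub (suc n) a v v∈H = IsSubspace.+∈ H-sub (IsSubspace.·∈ H-sub (a zero) (v∈H zero))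
    (lincomb∈ H-sub n (λ k → a (suc k)) (λ k → v (suc k)) (λ k → v∈H (suc k)))

  -- With P = Vanishes (entries in 𝔪) this is linear dependence of the images in (K/𝔪)ᵐ.
  record DependentModulo {p m n} (P : Pred (Tup m) p) (v : Fin n → Tup m) : Set (c ⊔ ℓ ⊔ p) where
    field
      coeff        : Fin n → Carrier
      unit-index   : Fin n
      coeff-isUnit : IsUnit (coeff unit-index)
      lincomb∈P    : P (lincomb n coeff v)

  eliminate : ∀ {m n} (y : Fin (suc n) → Tup m) (p : Fin m) (w : Carrier) → Fin n → Tup m
  eliminate y p w k i = y (suc k) i + - (y (suc k) p * w) * y zero i

  eliminate-pivot : ∀ {m n} (y : Fin (suc n) → Tup m) (p : Fin m) {w} → y zero p * w ≈ 1# →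
                    ∀ k → eliminate y p w k p ≈ 0#
  eliminate-pivot y p {w} y₀ₚw≈1 k = begin
    yₖₚ + - (yₖₚ * w) * y zero p   ≈⟨ +-congˡ (-‿distribˡ-* (yₖₚ * w) (y zero p)) ⟨
    yₖₚ + - ((yₖₚ * w) * y zero p) ≈⟨ +-congˡ (-‿cong yₖₚwy₀ₚ≈yₖₚ) ⟩
    yₖₚ + - yₖₚ                    ≈⟨ -‿inverseʳ yₖₚ ⟩
    0#                             ∎
    where
    yₖₚ = y (suc k) p
    yₖₚwy₀ₚ≈yₖₚ : (yₖₚ * w) * y zero p ≈ yₖₚ
    yₖₚwy₀ₚ≈yₖₚ = begin
      (yₖₚ * w) * y zero p ≈⟨ xy∙z≈x∙zy yₖₚ w (y zero p) ⟩
      yₖₚ * (y zero p * w) ≈⟨ *-congˡ y₀ₚw≈1 ⟩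
      yₖₚ * 1#             ≈⟨ *-identityʳ yₖₚ ⟩
      yₖₚ                  ∎

  lincomb-eliminate : ∀ {m n} (y : Fin (suc n) → Tup m) p w (b : Fin n → Carrier) i →
    lincomb (suc n) (sum (λ k → b k * - (y (suc k) p * w)) ∷ b) y i ≈ lincomb n b (eliminate y p w) i
  lincomb-eliminate {n = n} y p w b i = begin
    sum (λ k → b k * d k) * y zero i + lincomb n b (λ k → y (suc k)) i
      ≈⟨ +-cong (*-distribʳ-sum (y zero i) (λ k → b k * d k)) (lincomb-apply n b (λ k → y (suc k)) i) ⟩
    sum (λ k → (b k * d k) * y zero i) + sum (λ k → b k * y (suc k) i)
      ≈⟨ +-comm _ _ ⟩
    sum (λ k → b k * y (suc k) i) + sum (λ k → (b k * d k) * y zero i)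
      ≈⟨ ∑-distrib-+ (λ k → b k * y (suc k) i) (λ k → (b k * d k) * y zero i) ⟨
    sum (λ k → b k * y (suc k) i + (b k * d k) * y zero i)
      ≈⟨ sum-cong-≋ (λ k → solve 4 (λ b y d y₀ → b :* (y :+ d :* y₀) := b :* y :+ (b :* d) :* y₀)
                                  refl (b k) (y (suc k) i) (d k) (y zero i)) ⟨
    sum (λ k → b k * eliminate y p w k i)
      ≈⟨ lincomb-apply n b (eliminate y p w) i ⟨
    lincomb n b (eliminate y p w) i
      ∎
    where
    d : Fin n → Carrier
    d k = - (y (suc k) p * w)

  module LocalRing (𝔪 : Pred Carrier (c ⊔ ℓ)) (𝔪-isIdeal : IsIdeal 𝔪) (1∉𝔪 : ¬ 𝔪 1#)
                   (local : ∀ x → 𝔪 x ⊎ IsUnit x) where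
    open IsIdeal 𝔪-isIdeal

    isUnit⇒∉𝔪 : ∀ {x} → IsUnit x → ¬ 𝔪 x
    isUnit⇒∉𝔪 {x} (x′ , xx′≈1) x∈𝔪 = 1∉𝔪 (resp (trans (*-comm x′ x) xx′≈1) (*∈ x′ x∈𝔪))

    1+𝔪-isUnit : ∀ {j} → 𝔪 j → IsUnit (1# + j)
    1+𝔪-isUnit {j} j∈𝔪 with local (1# + j)
    ... | inj₂ 1+j-unit = 1+j-unit
    ... | inj₁ 1+j∈𝔪    = ⊥-elim (1∉𝔪 (resp 1+j-j≈1 (+∈ 1+j∈𝔪 (*∈ (- 1#) j∈𝔪))))
      where
      1+j-j≈1 : (1# + j) + - 1# * j ≈ 1#
      1+j-j≈1 = begin
        (1# + j) + - 1# * j ≈⟨ +-congˡ (-1*x≈-x j) ⟩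
        (1# + j) + - j      ≈⟨ +-assoc 1# j (- j) ⟩
        1# + (j + - j)      ≈⟨ +-congˡ (-‿inverseʳ j) ⟩
        1# + 0#             ≈⟨ +-identityʳ 1# ⟩
        1#                  ∎

    Vanishes : ∀ {m} → Pred (Tup m) (c ⊔ ℓ)
    Vanishes v = ∀ i → 𝔪 (v i)

    vanishes⊎InV' : ∀ {m} (v : Tup m) → Vanishes v ⊎ InV' v
    vanishes⊎InV' {zero}  v = inj₁ (λ ())
    vanishes⊎InV' {suc m} v with local (v zero) | vanishes⊎InV' (v ∘′ suc)
    ... | inj₂ v₀-unit | _                  = inj₂ (zero , v₀-unit)
    ... | inj₁ v₀∈𝔪    | inj₁ tail-vanishes = inj₁ λ { zero → v₀∈𝔪 ; (suc i) → tail-vanishes i }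
    ... | inj₁ _       | inj₂ (i , vᵢ-unit) = inj₂ (suc i , vᵢ-unit)

    head-dependent : ∀ {m n} (y : Fin (suc n) → Tup m) → Vanishes (y zero) → DependentModulo Vanishes y
    head-dependent {n = n} y y₀-vanishes = record
      { coeff        = 1# ∷ (λ _ → 0#)
      ; unit-index   = zero
      ; coeff-isUnit = 1# , *-identityʳ 1#
      ; lincomb∈P    = λ i → resp (sym (lincomb≈y₀ i)) (y₀-vanishes i)
      }
      where
      lincomb≈y₀ : ∀ i → lincomb (suc n) (1# ∷ (λ _ → 0#)) y i ≈ y zero i
      lincomb≈y₀ i = begin
        1# * y zero i + lincomb n (λ _ → 0#) (λ k → y (suc k)) i
          ≈⟨ +-cong (*-identityˡ (y zero i))
                    (trans (lincomb-apply n _ _ i) (sum≈0 (λ k → zeroˡ (y (suc k) i)))) ⟩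
        y zero i + 0#
          ≈⟨ +-identityʳ (y zero i) ⟩
        y zero i
          ∎

    pivot-step : ∀ {m n} (y : Fin (suc n) → Tup (suc m)) p {w} → y zero p * w ≈ 1# →
                 DependentModulo Vanishes (λ k → removeAt (eliminate y p w k) p) →
                 DependentModulo Vanishes y
    pivot-step {n = n} y p {w} y₀ₚw≈1 reduced = record
      { coeff        = sum (λ k → coeff k * - (y (suc k) p * w)) ∷ coeff
      ; unit-index   = suc unit-index
      ; coeff-isUnit = coeff-isUnit
      ; lincomb∈P    = λ i → resp (sym (lincomb-eliminate y p w coeff i)) (eliminated-vanishes i)
      }
      where
      open DependentModulo reduced
      eliminated-vanishes : Vanishes (lincomb n coeff (eliminate y p w))
      eliminated-vanishes i with p ≟ i
      ... | yes ≡.refl = resp (sym column-p≈0) zero∈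
        where
        column-p≈0 : lincomb n coeff (eliminate y p w) p ≈ 0#
        column-p≈0 = trans (lincomb-apply n coeff _ p)
          (sum≈0 (λ k → trans (*-congˡ (eliminate-pivot y p y₀ₚw≈1 k)) (zeroʳ (coeff k))))
      ... | no p≢i = ≡.subst (λ j → 𝔪 (lincomb n coeff (eliminate y p w) j)) (punchIn-punchOut p≢i)
          (resp (lincomb-reindex n coeff _ (punchIn p) (punchOut p≢i)) (lincomb∈P (punchOut p≢i)))

    residue-dependent : ∀ {m n} → m < n → (y : Fin n → Tup m) → DependentModulo Vanishes y
    residue-dependent {zero}  {suc n} _         y = head-dependent y (λ ())
    residue-dependent {suc m} {suc n} (s≤s m<n) y with vanishes⊎InV' (y zero)
    ... | inj₁ y₀-vanishes      = head-dependent y y₀-vanishes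
    ... | inj₂ (p , _ , y₀ₚw≈1) = pivot-step y p y₀ₚw≈1 (residue-dependent m<n _)

  module ExactlyThreeIdealsProperties (r : Carrier) (three : ExactlyThreeIdeals r) where
    private
      classify : (I : Pred Carrier (c ⊔ ℓ)) → IsIdeal I → IsZeroSet I ⊎ SameSet I ⟨ r ⟩ ⊎ IsFullSet I
      classify = proj₁ three
      ⟨r⟩-nonzero : ¬ IsZeroSet ⟨ r ⟩
      ⟨r⟩-nonzero = proj₁ (proj₂ three)
      ⟨r⟩-proper : ¬ IsFullSet ⟨ r ⟩
      ⟨r⟩-proper = proj₁ (proj₂ (proj₂ three))
      open IsIdeal (⟨⟩-isIdeal r)

    1∉⟨r⟩ : ¬ ⟨ r ⟩ 1#
    1∉⟨r⟩ 1∈⟨r⟩ = ⟨r⟩-proper (λ x → resp (*-identityʳ x) (*∈ x 1∈⟨r⟩))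

    ⟨r⟩-local : ∀ x → ⟨ r ⟩ x ⊎ IsUnit x
    ⟨r⟩-local x with classify ⟨ x ⟩ (⟨⟩-isIdeal x)
    ... | inj₁ (⟨x⟩⊆0 , _)          = inj₁ (resp (sym (⟨x⟩⊆0 x (x∈⟨x⟩ x))) zero∈)
    ... | inj₂ (inj₁ (⟨x⟩⊆⟨r⟩ , _)) = inj₁ (⟨x⟩⊆⟨r⟩ x (x∈⟨x⟩ x))
    ... | inj₂ (inj₂ ⟨x⟩-full)       = inj₂ (proj₁ (⟨x⟩-full 1#) , sym (proj₂ (⟨x⟩-full 1#)))

    open LocalRing ⟨ r ⟩ (⟨⟩-isIdeal r) 1∉⟨r⟩ ⟨r⟩-local using (1+𝔪-isUnit)

    r*r≈0 : r * r ≈ 0#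
    r*r≈0 with classify ⟨ r * r ⟩ (⟨⟩-isIdeal (r * r))
    ... | inj₁ (⟨r²⟩⊆0 , _)     = ⟨r²⟩⊆0 (r * r) (x∈⟨x⟩ (r * r))
    ... | inj₂ (inj₂ ⟨r²⟩-full) =
      ⊥-elim (1∉⟨r⟩ (r * proj₁ (⟨r²⟩-full 1#) , trans (proj₂ (⟨r²⟩-full 1#)) (*-assoc r r _)))
    -- r = r² y forces r (1 - r y) = 0 with 1 - r y a unit, so r = 0.
    ... | inj₂ (inj₁ (_ , ⟨r⟩⊆⟨r²⟩)) = ⊥-elim (⟨r⟩-nonzero ⟨r⟩-zero)
      where
      y : Carrier
      y = proj₁ (⟨r⟩⊆⟨r²⟩ r (x∈⟨x⟩ r))
      r≈r[ry] : r ≈ r * (r * y)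
      r≈r[ry] = trans (proj₂ (⟨r⟩⊆⟨r²⟩ r (x∈⟨x⟩ r))) (*-assoc r r y)
      r[1-ry]≈0 : r * (1# + r * - y) ≈ 0#
      r[1-ry]≈0 = begin
        r * (1# + r * - y)     ≈⟨ distribˡ r 1# (r * - y) ⟩
        r * 1# + r * (r * - y) ≈⟨ +-cong (*-identityʳ r) (*-congˡ (sym (-‿distribʳ-* r y))) ⟩
        r + r * - (r * y)      ≈⟨ +-congˡ (-‿distribʳ-* r (r * y)) ⟨
        r + - (r * (r * y))    ≈⟨ +-congˡ (-‿cong r≈r[ry]) ⟨
        r + - r                ≈⟨ -‿inverseʳ r ⟩
        0#                     ∎
      r≈0 : r ≈ 0#
      r≈0 with 1+𝔪-isUnit (- y , refl)
      ... | w , [1-ry]w≈1 = begin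
        r                        ≈⟨ *-identityʳ r ⟨
        r * 1#                   ≈⟨ *-congˡ [1-ry]w≈1 ⟨
        r * ((1# + r * - y) * w) ≈⟨ *-assoc r _ w ⟨
        (r * (1# + r * - y)) * w ≈⟨ *-congʳ r[1-ry]≈0 ⟩
        0# * w                   ≈⟨ zeroˡ w ⟩
        0#                       ∎
      ⟨r⟩-zero : IsZeroSet ⟨ r ⟩
      ⟨r⟩-zero = (λ { x (z , x≈rz) → trans x≈rz (trans (*-congʳ r≈0) (zeroˡ z)) })
               , (λ x x≈0 → resp (sym x≈0) zero∈)

  module SquareZeroMaximalIdeal (r : Carrier) (⟨r⟩-local : ∀ x → ⟨ r ⟩ x ⊎ IsUnit x)
                                (1∉⟨r⟩ : ¬ ⟨ r ⟩ 1#) (r*r≈0 : r * r ≈ 0#) where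
    open LocalRing ⟨ r ⟩ (⟨⟩-isIdeal r) 1∉⟨r⟩ ⟨r⟩-local

    ⟨r⟩*⟨r⟩≈0 : ∀ {x y} → ⟨ r ⟩ x → ⟨ r ⟩ y → x * y ≈ 0#
    ⟨r⟩*⟨r⟩≈0 {x} {y} (a , x≈ra) (b , y≈rb) = begin
      x * y             ≈⟨ *-cong x≈ra y≈rb ⟩
      (r * a) * (r * b) ≈⟨ interchange r a r b ⟩
      (r * r) * (a * b) ≈⟨ *-congʳ r*r≈0 ⟩
      0# * (a * b)      ≈⟨ zeroˡ (a * b) ⟩
      0#                ∎

    [1+sr][x+w]≈x+w+s[rx] : ∀ s x {w} → ⟨ r ⟩ w → (1# + s * r) * (x + w) ≈ x + w + s * (r * x)
    [1+sr][x+w]≈x+w+s[rx] s x {w} w∈⟨r⟩ = begin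
      (1# + s * r) * (x + w)           ≈⟨ distribʳ (x + w) 1# (s * r) ⟩
      1# * (x + w) + (s * r) * (x + w) ≈⟨ +-cong (*-identityˡ (x + w)) (*-assoc s r (x + w)) ⟩
      x + w + s * (r * (x + w))        ≈⟨ +-congˡ (*-congˡ (distribˡ r x w)) ⟩
      x + w + s * (r * x + r * w)      ≈⟨ +-congˡ (*-congˡ (+-congˡ (⟨r⟩*⟨r⟩≈0 (x∈⟨x⟩ r) w∈⟨r⟩))) ⟩
      x + w + s * (r * x + 0#)         ≈⟨ +-congˡ (*-congˡ (+-identityʳ (r * x))) ⟩
      x + w + s * (r * x)              ∎

    T-dependent : ∀ {m n} → m < n → (x : Fin n → Tup m) → (∀ k → InT r (x k)) →
                  DependentModulo (_≋ 𝟎) x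
    T-dependent {m} {n} m<n x x∈T = record
      { coeff        = coeff
      ; unit-index   = unit-index
      ; coeff-isUnit = coeff-isUnit
      ; lincomb∈P    = lincomb≈0
      }
      where
      y : Fin n → Tup m
      y k i = proj₁ (x∈T k i)
      open DependentModulo (residue-dependent m<n y)
      lincomb≈0 : lincomb n coeff x ≋ 𝟎
      lincomb≈0 i = begin
        lincomb n coeff x i               ≈⟨ lincomb-apply n coeff x i ⟩
        sum (λ k → coeff k * x k i)       ≈⟨ sum-cong-≋ (λ k → *-congˡ (proj₂ (x∈T k i))) ⟩
        sum (λ k → coeff k * (r * y k i)) ≈⟨ sum-cong-≋ (λ k → x∙yz≈y∙xz (coeff k) r (y k i)) ⟩
        sum (λ k → r * (coeff k * y k i)) ≈⟨ *-distribˡ-sum r (λ k → coeff k * y k i) ⟨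
        r * sum (λ k → coeff k * y k i)   ≈⟨ *-congˡ (lincomb-apply n coeff y i) ⟨
        r * lincomb n coeff y i           ≈⟨ ⟨r⟩*⟨r⟩≈0 (x∈⟨x⟩ r) (lincomb∈P i) ⟩
        0#                                ∎

    -- t, r·u and a basis of H are m + 1 elements of T, hence dependent; the unit coefficient
    -- can sit neither on r·u (as r·u ∉ H) nor on the basis (by independence), so it sits on t.
    hyperplane-decomposition : ∀ {m} {H : Pred (Tup m) (c ⊔ ℓ)} {u : Tup m} →
                               IsHyperplane r H → ¬ H (r · u) → ∀ {t} → InT r t →
                               Σ (Tup m) λ k → Σ Carrier λ s → H k × t ≋ (k ⊕ (s · (r · u)))
    hyperplane-decomposition {m} {H} {u} (H-sub , b , b-basis) ru∉H {t} t∈T =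
      decompose (⟨r⟩-local a₀) (⟨r⟩-local a₁)
      where
      open IsSubspace H-sub
      open IsBasis b-basis
      d : ℕ
      d = m ∸ 1
      x : Fin (suc (suc d)) → Tup m
      x = t ∷ (r · u) ∷ b
      x∈T : ∀ k → InT r (x k)
      x∈T zero          = t∈T
      x∈T (suc zero)    = λ i → u i , refl
      x∈T (suc (suc j)) = ⊆T (inH j)
      open DependentModulo (T-dependent (s≤s (m≤n+m∸n m 1)) x x∈T)
      a₀ a₁ : Carrier
      a₀ = coeff zero
      a₁ = coeff (suc zero)
      L : Tup m
      L = lincomb d (λ j → coeff (suc (suc j))) b
      L∈H : H L
      L∈H = lincomb∈ H-sub d _ b inH
      relation : ∀ i → a₀ * t i + (a₁ * (r * u i) + L i) ≈ 0#
      relation = lincomb∈P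
      relation′ : ⟨ r ⟩ a₀ → ∀ i → a₁ * (r * u i) + L i ≈ 0#
      relation′ a₀∈⟨r⟩ i = trans (sym (+-identityˡ _))
        (trans (+-congʳ (sym (⟨r⟩*⟨r⟩≈0 a₀∈⟨r⟩ (t∈T i)))) (relation i))
      decompose : ⟨ r ⟩ a₀ ⊎ IsUnit a₀ → ⟨ r ⟩ a₁ ⊎ IsUnit a₁ →
                  Σ (Tup m) λ k → Σ Carrier λ s → H k × t ≋ (k ⊕ (s · (r · u)))
      decompose (inj₂ (w , a₀w≈1)) _ = (- w) · L , - w * a₁ , ·∈ (- w) L∈H , λ i →
        trans (x*w≈1∧xy+z≈0⇒y≈-wz a₀w≈1 (relation i))
              (solve 4 (λ w a v l → w :* (a :* v :+ l) := w :* l :+ (w :* a) :* v)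
                       refl (- w) a₁ (r * u i) (L i))
      decompose (inj₁ a₀∈⟨r⟩) (inj₂ (w , a₁w≈1)) =
        ⊥-elim (ru∉H (resp (λ i → sym (x*w≈1∧xy+z≈0⇒y≈-wz a₁w≈1 (relation′ a₀∈⟨r⟩ i))) (·∈ (- w) L∈H)))
      decompose (inj₁ a₀∈⟨r⟩) (inj₁ a₁∈⟨r⟩) = ⊥-elim (isUnit⇒∉𝔪 coeff-isUnit (coeff∈⟨r⟩ unit-index))
        where
        L≋0 : L ≋ 𝟎
        L≋0 i = trans (sym (+-identityˡ (L i)))
          (trans (+-congʳ (sym (⟨r⟩*⟨r⟩≈0 a₁∈⟨r⟩ (u i , refl)))) (relation′ a₀∈⟨r⟩ i))
        coeff∈⟨r⟩ : ∀ k → ⟨ r ⟩ (coeff k)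
        coeff∈⟨r⟩ zero          = a₀∈⟨r⟩
        coeff∈⟨r⟩ (suc zero)    = a₁∈⟨r⟩
        coeff∈⟨r⟩ (suc (suc j)) = indep _ L≋0 j

    associate-shift : ∀ {m} {H₁ H₂ : Pred (Tup m) (c ⊔ ℓ)} {u₁ u₂ h₁ h₂ g₁ : Tup m} {α} →
      IsSubspace r H₁ → IsHyperplane r H₂ → ¬ H₂ (r · u₂) → H₁ h₁ → H₂ h₂ → H₁ g₁ →
      IsUnit α → (u₁ ⊕ h₁) ≋ (α · (u₂ ⊕ h₂)) →
      Σ (Tup m) λ h → H₂ h × Σ Carrier λ μ → IsUnit μ × (u₁ ⊕ g₁) ≋ (μ · (u₂ ⊕ h))
    associate-shift {m} {H₁} {H₂} {u₁} {u₂} {h₁} {h₂} {g₁} {α}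
                    H₁-sub H₂-hyp ru₂∉H₂ h₁∈H₁ h₂∈H₂ g₁∈H₁ α-unit@(α′ , αα′≈1) u₁+h₁≋α[u₂+h₂] =
      shift (hyperplane-decomposition H₂-hyp ru₂∉H₂ (S₁.⊆T t∈H₁))
      where
      module S₁ = IsSubspace H₁-sub
      module S₂ = IsSubspace (proj₁ H₂-hyp)
      t : Tup m
      t = α′ · (g₁ ⊕ ((- 1#) · h₁))
      t∈H₁ : H₁ t
      t∈H₁ = S₁.·∈ α′ (S₁.+∈ g₁∈H₁ (S₁.·∈ (- 1#) h₁∈H₁))
      shift : (Σ (Tup m) λ k → Σ Carrier λ s → H₂ k × t ≋ (k ⊕ (s · (r · u₂)))) →
              Σ (Tup m) λ h → H₂ h × Σ Carrier λ μ → IsUnit μ × (u₁ ⊕ g₁) ≋ (μ · (u₂ ⊕ h))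
      shift (k , s , k∈H₂ , t≋k+s[ru₂]) =
        h₂ ⊕ k , S₂.+∈ h₂∈H₂ k∈H₂ , α * (1# + s * r) , isUnit-* α-unit (1+𝔪-isUnit (s , *-comm s r)) ,
        λ i → begin
          u₁ i + g₁ i
            ≈⟨ [x+y]+[z-y]≈x+z (u₁ i) (h₁ i) (g₁ i) ⟨
          (u₁ i + h₁ i) + (g₁ i + - 1# * h₁ i)
            ≈⟨ +-congˡ (inverse-cancelˡ (trans (*-comm α′ α) αα′≈1) _) ⟨
          (u₁ i + h₁ i) + α * t i
            ≈⟨ +-cong (u₁+h₁≋α[u₂+h₂] i) (*-congˡ (t≋k+s[ru₂] i)) ⟩
          α * (u₂ i + h₂ i) + α * (k i + s * (r * u₂ i))
            ≈⟨ a[x+y]+a[z+w]≈a[x+[y+z]+w] α (u₂ i) (h₂ i) (k i) (s * (r * u₂ i)) ⟩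
          α * (u₂ i + (h₂ i + k i) + s * (r * u₂ i))
            ≈⟨ *-congˡ ([1+sr][x+w]≈x+w+s[rx] s (u₂ i) (h₂+k∈⟨r⟩ k∈H₂ i)) ⟨
          α * ((1# + s * r) * (u₂ i + (h₂ i + k i)))
            ≈⟨ *-assoc α _ _ ⟨
          (α * (1# + s * r)) * (u₂ i + (h₂ i + k i))
            ∎
        where
        h₂+k∈⟨r⟩ : ∀ {k} → H₂ k → ∀ i → ⟨ r ⟩ (h₂ i + k i)
        h₂+k∈⟨r⟩ k∈H₂ i = IsIdeal.+∈ (⟨⟩-isIdeal r) (S₂.⊆T h₂∈H₂ i) (S₂.⊆T k∈H₂ i)

    C-transfer : ∀ {m} {H₁ H₂ : Pred (Tup m) (c ⊔ ℓ)} {u₁ u₂ : Tup m} →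
                 IsSubspace r H₁ → IsHyperplane r H₂ → ¬ H₂ (r · u₂) →
                 ∀ {X Y} → X ∈C[ H₁ , u₁ ] → X ∈C[ H₂ , u₂ ] → Y ∈C[ H₁ , u₁ ] → Y ∈C[ H₂ , u₂ ]
    C-transfer {u₁ = u₁} H₁-sub H₂-hyp ru₂∉H₂ (h₁ , h₁∈H₁ , X≐₁) (h₂ , h₂∈H₂ , X≐₂) (g₁ , g₁∈H₁ , Y≐) =
      let α , α-unit , u₁+h₁≋α[u₂+h₂] = proj₁ X≐₂ (u₁ ⊕ h₁) (proj₂ X≐₁ (u₁ ⊕ h₁) (Cls-refl (u₁ ⊕ h₁)))
          h , h∈H₂ , μ , μ-unit , u₁+g₁≋μ[u₂+h] =
            associate-shift H₁-sub H₂-hyp ru₂∉H₂ h₁∈H₁ h₂∈H₂ g₁∈H₁ α-unit u₁+h₁≋α[u₂+h₂]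
      in h , h∈H₂ , ≐-trans Y≐ (Cls-cong μ-unit u₁+g₁≋μ[u₂+h])

open import Data.Nat using (_*_)

proposition3p6 : {c ℓ : Level} (K : CommutativeRing c ℓ) →
    let open CommutativeRing K using (Carrier) in
    let open RingDefs K in
    (r : Carrier) → Finite → ExactlyThreeIdeals r →
    (e : ℕ) → 2 ≤ e →
    (H₁ H₂ : Pred (Tup (2 * e)) (c ⊔ ℓ)) →
    IsHyperplane r H₁ → IsHyperplane r H₂ →
    (u₁ u₂ : Tup (2 * e)) → InV' u₁ → InV' u₂ →
    ¬ H₁ (r · u₁) → ¬ H₂ (r · u₂) →
    CMeet H₁ u₁ H₂ u₂ → CEq H₁ u₁ H₂ u₂
proposition3p6 K r _ three _ _ _ _ H₁-hyp H₂-hyp _ _ _ _ ru₁∉H₁ ru₂∉H₂ (X , X∈C₁ , X∈C₂) Y =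
    C-transfer (proj₁ H₁-hyp) H₂-hyp ru₂∉H₂ X∈C₁ X∈C₂
  , C-transfer (proj₁ H₂-hyp) H₁-hyp ru₁∉H₁ X∈C₂ X∈C₁
  where
  open ExactlyThreeIdealsProperties K r three
  open SquareZeroMaximalIdeal K r ⟨r⟩-local 1∉⟨r⟩ r*r≈0
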